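{- Let $0<\varepsilon\le\frac12$, $\Phi$ a non-trivial CNF Boolean formula, and $G=G(\Phi,\varepsilon)$ the formula graph on $n$ vertices. Then either $\widehat\delta(G)/n>1-\varepsilon$ or $\widehat\delta(G)/n\le\varepsilon$.
   Context: $\widehat\delta(G)$ (greedegree) is the maximum over greedy orderings of $G$ of the degree of the final vertex, where an ordering $(v_1,\dots,v_n)$ is greedy if for all $i\le j$, $|\{h<i:v_hv_i\in E\}|\ge|\{h<i:v_hv_j\in E\}|$. Formula graph construction: write $\Phi=c_1\wedge\cdots\wedge c_k$, clause $c_i$ a disjunction of $w_i$ distinct literals; atoms $x_1,\dots,x_t$; $p(\ell)$ = number of clauses containing literal $\ell$; $m=\max\{w_i,2p(\ell)\}$ over all clauses and literals. $n(f)=2+2t+2k+f$, $f$ the least integer with $f\ge m$, $n(f)\ge\frac1\varepsilon(2t+k)$, $n(f)\ge\frac1\varepsilon(m+3)$; $n=n(f)$. Vertices: $a,b$, literal vertices $x_i,\neg x_i$, clause vertices $\alpha_i,\beta_i$, fillers $y_1,\dots,y_f$. Graph $H$ has edges $ab$; $x_i\neg x_i$; $\alpha_i$ to $a$ and to the literals of $c_i$; $\beta_i$ to $b$ and to the literals of $c_i$; each $y_i$ to $a$ and $b$. $G(\Phi,\varepsilon)$ is the complement of $H$. -}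

module Defs where

open import Data.Nat using (ℕ; zero; suc; _+_; _*_; _≤_; _<_; _⊔_)
open import Data.Bool using (Bool; true; false; _∧_; _∨_; not; if_then_else_)
open import Data.Fin using (Fin; toℕ; fromℕ)
import Data.Fin as Fin
open import Data.List using (List; []; _∷_; length; lookup; map; foldr)
open import Data.List.Relation.Unary.All using (All)
open import Data.List.Relation.Unary.Unique.Propositional using (Unique)
open import Data.Product using (Σ; _×_; _,_; ∃)
open import Data.Sum using (_⊎_)
open import Function.Bundles using (_↔_; Inverse)
open import Relation.Binary.PropositionalEquality using (_≡_)
open import Relation.Nullary using (¬_; does)

count : (n : ℕ) → (Fin n → Bool) → ℕ
count zero    P = 0
count (suc n) P = (if P Fin.zero then 1 else 0) + count n (λ i → P (Fin.suc i))

-- Graphs: a vertex type V with a Boolean adjacency relation.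
-- An ordering of an n-vertex graph is a bijection  Fin n ↔ V
-- (position i ↦ the i-th vertex v_i).

module _ {V : Set} (adj : V → V → Bool) {n : ℕ} (σ : Fin n ↔ V) where
  open Inverse σ renaming (to to ord)

  backNbrs : Fin n → Fin n → ℕ
  backNbrs i j = count n (λ h → does (toℕ h Data.Nat.<? toℕ i) ∧ adj (ord h) (ord j))

  IsGreedy : Set
  IsGreedy = ∀ (i j : Fin n) → toℕ i ≤ toℕ j → backNbrs i j ≤ backNbrs i i

  degree : V → ℕ
  degree v = count n (λ h → adj (ord h) v)

finalDegree : {V : Set} (adj : V → V → Bool) {n : ℕ} (σ : Fin (suc n) ↔ V) → ℕ
finalDegree adj {n} σ = degree adj σ (Inverse.to σ (fromℕ n))

IsGreedegree : {V : Set} (adj : V → V → Bool) (n : ℕ) → ℕ → Set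
IsGreedegree {V} adj n d =
  (Σ (Fin (suc n) ↔ V) λ σ → IsGreedy adj σ × finalDegree adj σ ≡ d)
  × (∀ (σ : Fin (suc n) ↔ V) → IsGreedy adj σ → finalDegree adj σ ≤ d)

-- a literal: atom index and polarity (true = x_i, false = ¬x_i)
Literal : ℕ → Set
Literal t = Fin t × Bool

_≟ᴸ_ : {t : ℕ} → Literal t → Literal t → Bool
(i , p) ≟ᴸ (j , q) = does (i Fin.≟ j) ∧ does (p Data.Bool.≟ q)

Clause : ℕ → Set
Clause t = List (Literal t)

record CNF (t : ℕ) : Set where
  field
    clauses  : List (Clause t)
    distinct : All Unique clauses
open CNF public

NonTrivial : {t : ℕ} → CNF t → Set
NonTrivial Φ = ¬ (clauses Φ ≡ []) × All (λ c → ¬ (c ≡ [])) (clauses Φ)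

memᴸ : {t : ℕ} → Literal t → Clause t → Bool
memᴸ ℓ []       = false
memᴸ ℓ (l ∷ ls) = (ℓ ≟ᴸ l) ∨ memᴸ ℓ ls

module _ {t : ℕ} (Φ : CNF t) where
  nClauses : ℕ
  nClauses = length (clauses Φ)

  clause : Fin nClauses → Clause t
  clause i = lookup (clauses Φ) i

  occ : Literal t → ℕ
  occ ℓ = count nClauses (λ i → memᴸ ℓ (clause i))

  maxParam : ℕ
  maxParam = foldr _⊔_ 0 (map length (clauses Φ))
           ⊔ maxLit t (λ i → i)
    where
    maxLit : (s : ℕ) → (Fin s → Fin t) → ℕ
    maxLit zero    g = 0
    maxLit (suc s) g = (2 * occ (g Fin.zero , true)) ⊔ (2 * occ (g Fin.zero , false))
                       ⊔ maxLit s (λ i → g (Fin.suc i))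

  nOf : ℕ → ℕ
  nOf f = 2 + 2 * t + 2 * nClauses + f

  -- ε = r / s.  Conditions on f:  f ≥ m,  n(f) ≥ (1/ε)(2t+k),  n(f) ≥ (1/ε)(m+3)
  FillerOK : (r s : ℕ) → ℕ → Set
  FillerOK r s f = maxParam ≤ f
                 × s * (2 * t + nClauses) ≤ r * nOf f
                 × s * (maxParam + 3) ≤ r * nOf f

  IsFillerCount : (r s : ℕ) → ℕ → Set
  IsFillerCount r s f = FillerOK r s f × (∀ f′ → FillerOK r s f′ → f ≤ f′)

  data Vtx (f : ℕ) : Set where
    va vb : Vtx f
    lit   : Literal t → Vtx f
    α β   : Fin nClauses → Vtx f
    y     : Fin f → Vtx f

  module _ {f : ℕ} where
    eqV : Vtx f → Vtx f → Bool
    eqV va va = true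
    eqV vb vb = true
    eqV (lit ℓ) (lit ℓ′) = ℓ ≟ᴸ ℓ′
    eqV (α i) (α j) = does (i Fin.≟ j)
    eqV (β i) (β j) = does (i Fin.≟ j)
    eqV (y i) (y j) = does (i Fin.≟ j)
    eqV _ _ = false

    -- one orientation of the edges of H
    hEdge : Vtx f → Vtx f → Bool
    hEdge va vb = true
    hEdge (lit (i , true)) (lit (j , false)) = does (i Fin.≟ j)
    hEdge (α i) va = true
    hEdge (α i) (lit ℓ) = memᴸ ℓ (clause i)
    hEdge (β i) vb = true
    hEdge (β i) (lit ℓ) = memᴸ ℓ (clause i)
    hEdge (y i) va = true
    hEdge (y i) vb = true
    hEdge _ _ = false

    hAdj : Vtx f → Vtx f → Bool
    hAdj u v = hEdge u v ∨ hEdge v u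

    gAdj : Vtx f → Vtx f → Bool
    gAdj u v = not (eqV u v) ∧ not (hAdj u v)

module Submission where

-- In the complement G of H a vertex v has n − |N_H[v]| neighbours, N_H[v] being its closed
-- neighbourhood in H. The vertices a and b are adjacent in G only to the 2t literal vertices and
-- to the k clause vertices of the other side, so their degree is at most 2t + k ≤ εn. Every other
-- vertex has |N_H[v]| ≤ m + 2 (a literal ℓ: itself, ¬ℓ and 2p(ℓ) clause vertices; a clause vertex:
-- itself, a or b, and its w_i literals; a filler: itself, a and b, and m ≥ 1), so its degree is at
-- least n − (m + 2) > (1 − ε)n. Whatever the final vertex of a greedy ordering, its degree is thus
-- on one side of the gap. The greedegree exists because greedy orderings do (fill the positions in
-- turn with a remaining vertex having the most earlier neighbours) and there are finitely many.

open import Defs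
open import Data.Bool using (Bool; true; false; _∧_; _∨_; not; if_then_else_; T)
open import Data.Bool.Properties using (∨-identityʳ; ∧-identityʳ; ∧-zeroʳ)
open import Data.Fin using (Fin; zero; suc; toℕ; fromℕ; fromℕ<; _↑ˡ_; _↑ʳ_)
import Data.Fin as Fin
open import Data.Fin.Permutation using (Permutation; transpose; cast-id)
import Data.Fin.Permutation.Components as PC
open import Data.Fin.Properties
  using (_≟_; any?; all?; toℕ-injective; toℕ-fromℕ<; toℕ<n; +↔⊎; splitAt-↑ˡ; splitAt-↑ʳ)
open import Data.List using (List; []; _∷_; length; lookup; foldr; map)
open import Data.List.Relation.Unary.All using (All; _∷_)
open import Data.Nat using (ℕ; zero; suc; _+_; _*_; _≤_; _<_; _⊔_; z≤n; s≤s; s≤s⁻¹; _≤?_; _<?_; _<ᵇ_)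
open import Data.Nat.Properties
  using ( ≤-refl; ≤-trans; ≤-reflexive; <⇒≤; <-irrefl; <-≤-trans; <ᵇ⇒<; n≤1+n; m≤n⇒m≤1+n; n≤0⇒n≡0
        ; ≤∧≢⇒<; m≤n⇒m<n∨m≡n; +-suc; +-assoc; +-comm; +-mono-≤; +-monoʳ-≤; +-monoʳ-<; m≤m+n
        ; *-monoʳ-≤; *-monoʳ-<; *-distribˡ-+; m≤m⊔n; m≤n⊔m
        ; +-0-commutativeMonoid; +-commutativeSemigroup; module ≤-Reasoning)
  renaming (_≟_ to _≟ℕ_)
open import Data.Nat.Base using (>-nonZero)
open import Algebra.Properties.CommutativeMonoid.Sum +-0-commutativeMonoid using (sum; sum-permute)
open import Algebra.Properties.CommutativeSemigroup +-commutativeSemigroup using (interchange)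
open import Data.Nat.Tactic.RingSolver using (solve-∀)
open import Data.Product using (Σ; ∃; _×_; _,_; proj₁; proj₂)
open import Data.Unit using (tt)
open import Data.Sum using (_⊎_; inj₁; inj₂)
import Data.Sum as ⊎
open import Data.Sum.Function.Propositional using (_⊎-↔_)
import Data.Vec.Functional as Vector
open import Function using (_∘_; id)
open import Function.Bundles using (_↔_; Inverse; mk↔ₛ′)
open import Function.Construct.Identity using (↔-id)
open import Function.Properties.Inverse using (↔-trans; ↔-sym)
open import Relation.Binary.PropositionalEquality
  using (_≡_; _≗_; refl; sym; trans; cong; cong₂; subst; subst₂; module ≡-Reasoning)
open import Relation.Nullary using (¬_; Dec; yes; no; does; contradiction)
open import Relation.Nullary.Decidable using (map′; _×-dec_; _→-dec_)

open Inverse using (to; from; strictlyInverseˡ; strictlyInverseʳ)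

-- Counting

indicator : Bool → ℕ
indicator b = if b then 1 else 0

count-cong : ∀ n {P Q : Fin n → Bool} → P ≗ Q → count n P ≡ count n Q
count-cong zero    P≗Q = refl
count-cong (suc n) P≗Q =
  cong₂ _+_ (cong indicator (P≗Q zero)) (count-cong n (P≗Q ∘ suc))

count-≤ : ∀ n {P : Fin n → Bool} → count n P ≤ n
count-≤ zero        = z≤n
count-≤ (suc n) {P} with P zero
... | true  = s≤s (count-≤ n)
... | false = m≤n⇒m≤1+n (count-≤ n)

count-false : ∀ n → count n (λ _ → false) ≡ 0
count-false zero    = refl
count-false (suc n) = count-false n

count-∨ : ∀ n (P Q : Fin n → Bool) → count n (λ i → P i ∨ Q i) ≤ count n P + count n Q
count-∨ zero    P Q = z≤n
count-∨ (suc n) P Q with P zero | Q zero | count-∨ n (P ∘ suc) (Q ∘ suc)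
... | true  | true  | ih = s≤s (≤-trans ih (+-monoʳ-≤ _ (n≤1+n _)))
... | true  | false | ih = s≤s ih
... | false | true  | ih = ≤-trans (s≤s ih) (≤-reflexive (sym (+-suc _ _)))
... | false | false | ih = ih

count-not : ∀ n (P : Fin n → Bool) → count n P + count n (not ∘ P) ≡ n
count-not zero    P = refl
count-not (suc n) P with P zero
... | true  = cong suc (count-not n (P ∘ suc))
... | false = trans (+-suc _ _) (cong suc (count-not n (P ∘ suc)))

count-≟ : ∀ {n} (i : Fin n) → count n (λ j → does (j ≟ i)) ≡ 1
count-≟ {suc n} zero = cong suc (count-false n)
count-≟ (suc i)      = count-≟ i

count-≟′ : ∀ {n} (i : Fin n) → count n (λ j → does (i ≟ j)) ≡ 1
count-≟′ {suc n} zero = cong suc (count-false n)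
count-≟′ (suc i)      = count-≟′ i

count-+ : ∀ m {n} (P : Fin (m + n) → Bool) →
          count (m + n) P ≡ count m (λ i → P (i ↑ˡ n)) + count n (λ i → P (m ↑ʳ i))
count-+ zero    P = refl
count-+ (suc m) P =
  trans (cong (indicator (P zero) +_) (count-+ m (P ∘ suc))) (sym (+-assoc (indicator (P zero)) _ _))

count≡sum : ∀ n (P : Fin n → Bool) → count n P ≡ sum (indicator ∘ P)
count≡sum zero    P = refl
count≡sum (suc n) P = cong (indicator (P zero) +_) (count≡sum n (P ∘ suc))

count-reindex : ∀ {A : Set} {m n} (σ : Fin m ↔ A) (τ : Fin n ↔ A) (Q : A → Bool) →
                count m (Q ∘ to σ) ≡ count n (Q ∘ to τ)
count-reindex {m = m} {n} σ τ Q = begin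
  count m (Q ∘ to σ)                     ≡⟨ count-cong m (λ i → cong Q (strictlyInverseˡ τ (to σ i))) ⟨
  count m (Q ∘ to τ ∘ to π)              ≡⟨ count≡sum m _ ⟩
  sum (weight ∘ to π)                    ≡⟨ sum-permute weight π ⟨
  sum weight                             ≡⟨ count≡sum n _ ⟨
  count n (Q ∘ to τ)                     ∎
  where
  open ≡-Reasoning
  π = ↔-trans σ (↔-sym τ)
  weight : Fin n → ℕ
  weight = indicator ∘ Q ∘ to τ

_⊕_ : ∀ {A B : Set} {m n} → Fin m ↔ A → Fin n ↔ B → Fin (m + n) ↔ (A ⊎ B)
σ ⊕ τ = ↔-trans +↔⊎ (σ ⊎-↔ τ)

count-⊕ : ∀ {A B : Set} {m n} (σ : Fin m ↔ A) (τ : Fin n ↔ B) (Q : A ⊎ B → Bool) →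
          count (m + n) (Q ∘ to (σ ⊕ τ)) ≡ count m (Q ∘ inj₁ ∘ to σ) + count n (Q ∘ inj₂ ∘ to τ)
count-⊕ {m = m} {n} σ τ Q = trans (count-+ m _) (cong₂ _+_
  (count-cong m (λ i → cong (Q ∘ ⊎.map (to σ) (to τ)) (splitAt-↑ˡ m i n)))
  (count-cong n (λ i → cong (Q ∘ ⊎.map (to σ) (to τ)) (splitAt-↑ʳ m n i))))

-- Finite search

greatest : (P : ℕ → Set) → (∀ c → Dec (P c)) → ∀ B → (∀ c → P c → c ≤ B) → ∃ P →
           ∃ λ d → P d × ∀ c → P c → c ≤ d
greatest P P? B bounded inhabited with P? B
... | yes p = B , p , bounded
greatest P P? zero bounded (c , p) | no ¬p = contradiction (subst P (n≤0⇒n≡0 (bounded c p)) p) ¬p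
greatest P P? (suc B) bounded inhabited | no ¬p =
  greatest P P? B (λ c p → s≤s⁻¹ (≤∧≢⇒< (bounded c p) λ { refl → ¬p p })) inhabited

argmax : ∀ {n} {P : Fin n → Set} → (∀ j → Dec (P j)) → (W : Fin n → ℕ) → ∀ {B} → (∀ j → W j ≤ B) →
         ∃ P → ∃ λ j → P j × ∀ i → P i → W i ≤ W j
argmax {P = P} P? W {B} bounded (i , pᵢ) =
  let d , (j , pⱼ , Wⱼ≡d) , maximal = greatest Value value? B
                                        (λ c (j , _ , Wⱼ≡c) → subst (_≤ B) Wⱼ≡c (bounded j))
                                        (W i , i , pᵢ , refl)
  in j , pⱼ , λ i pᵢ → subst (W i ≤_) (sym Wⱼ≡d) (maximal (W i) (i , pᵢ , refl))
  where
  Value : ℕ → Set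
  Value c = ∃ λ j → P j × W j ≡ c
  value? : ∀ c → Dec (Value c)
  value? c = any? λ j → P? j ×-dec (W j ≟ℕ c)

∃-function? : ∀ m {n} {R : (Fin m → Fin n) → Set} → (∀ g → Dec (R g)) →
              (∀ {g h} → g ≗ h → R g → R h) → Dec (∃ R)
∃-function? zero    R? R-resp = map′ (_ ,_) (λ (g , r) → R-resp (λ ()) r) (R? (λ ()))
∃-function? (suc m) R? R-resp =
  map′ (λ (x , g , r) → x Vector.∷ g , r)
       (λ (g , r) → g zero , g ∘ suc , R-resp (λ { zero → refl ; (suc i) → refl }) r)
       (any? λ x → ∃-function? m (R? ∘ (x Vector.∷_))
                     (λ g≗h → R-resp λ { zero → refl ; (suc i) → g≗h i }))

∃-permutation? : ∀ {n} {Q : (Fin n → Fin n) → Set} → (∀ g → Dec (Q g)) →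
                 (∀ {g h} → g ≗ h → Q g → Q h) → Dec (∃ λ (π : Permutation n n) → Q (to π))
∃-permutation? {n} {Q} Q? Q-resp = map′ fromBijection toBijection (∃-function? n R? R-resp)
  where
  Bijective : (Fin n → Fin n) → Set
  Bijective g = (∀ i j → g i ≡ g j → i ≡ j) × (∀ j → ∃ λ i → g i ≡ j)

  R : (Fin n → Fin n) → Set
  R g = Bijective g × Q g

  R? : ∀ g → Dec (R g)
  R? g = (all? (λ i → all? λ j → (g i ≟ g j) →-dec (i ≟ j)) ×-dec all? (λ j → any? λ i → g i ≟ j))
         ×-dec Q? g

  R-resp : ∀ {g h} → g ≗ h → R g → R h
  R-resp g≗h ((inj , surj) , q) =
      ( (λ i j e → inj i j (trans (g≗h i) (trans e (sym (g≗h j)))))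
      , (λ j → let i , e = surj j in i , trans (sym (g≗h i)) e) )
    , Q-resp g≗h q

  fromBijection : ∃ R → ∃ λ (π : Permutation n n) → Q (to π)
  fromBijection (g , (inj , surj) , q) =
    mk↔ₛ′ g (proj₁ ∘ surj) (proj₂ ∘ surj) (λ i → inj _ _ (proj₂ (surj (g i)))) , q

  toBijection : (∃ λ (π : Permutation n n) → Q (to π)) → ∃ R
  toBijection (π , q) =
      to π
    , ( (λ i j e → trans (sym (strictlyInverseʳ π i)) (trans (cong (from π) e) (strictlyInverseʳ π j)))
      , (λ j → from π j , strictlyInverseˡ π j) )
    , q

∃-ordering? : ∀ {V : Set} {n} → Fin n ↔ V → {P : (Fin n → V) → Set} → (∀ g → Dec (P g)) →
              (∀ {g h} → g ≗ h → P g → P h) → Dec (∃ λ (σ : Fin n ↔ V) → P (to σ))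
∃-ordering? E P? P-resp =
  map′ (λ (π , p) → ↔-trans π E , p)
       (λ (σ , p) → ↔-trans σ (↔-sym E) , P-resp (λ i → sym (strictlyInverseˡ E (to σ i))) p)
       (∃-permutation? (P? ∘ (to E ∘_)) (λ g≗h → P-resp (cong (to E) ∘ g≗h)))

-- Greedy orderings

transpose-at : ∀ {n} (i j : Fin n) → PC.transpose i j i ≡ j
transpose-at i j with i ≟ i
... | yes _  = refl
... | no i≢i = contradiction refl i≢i

transpose-fixes-below : ∀ {n} {i j x : Fin n} → toℕ x < toℕ i → toℕ x < toℕ j → PC.transpose i j x ≡ x
transpose-fixes-below {i = i} {j} {x} x<i x<j with x ≟ i
... | yes refl = contradiction x<i (<-irrefl refl)
... | no _ with x ≟ j
...   | yes refl = contradiction x<j (<-irrefl refl)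
...   | no _     = refl

transpose-keeps-above : ∀ {n b} (i j x : Fin n) → b ≤ toℕ i → b ≤ toℕ j → b ≤ toℕ x →
                        b ≤ toℕ (PC.transpose i j x)
transpose-keeps-above i j x b≤i b≤j b≤x with does (x ≟ i)
... | true  = b≤j
... | false with does (x ≟ j)
...   | true  = b≤i
...   | false = b≤x

module _ {V : Set} (adj : V → V → Bool) {n : ℕ} where

  -- The notions of Defs for plain functions, so that they can be searched: `Greedy (to σ)` is
  -- `IsGreedy adj σ` by definition.
  backCount : (Fin n → V) → Fin n → Fin n → ℕ
  backCount g i j = count n (λ h → does (toℕ h <? toℕ i) ∧ adj (g h) (g j))

  Greedy : (Fin n → V) → Set
  Greedy g = ∀ i j → toℕ i ≤ toℕ j → backCount g i j ≤ backCount g i i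

  GreedyBelow : ℕ → (Fin n → V) → Set
  GreedyBelow k g = ∀ i j → toℕ i < k → toℕ i ≤ toℕ j → backCount g i j ≤ backCount g i i

  backCount-cong : ∀ {g g′} → g ≗ g′ → ∀ i j → backCount g i j ≡ backCount g′ i j
  backCount-cong g≗g′ i j =
    count-cong n (λ h → cong₂ (λ u v → does (toℕ h <? toℕ i) ∧ adj u v) (g≗g′ h) (g≗g′ j))

  greedy-cong : ∀ {g g′} → g ≗ g′ → Greedy g → Greedy g′
  greedy-cong g≗g′ greedy i j i≤j =
    subst₂ _≤_ (backCount-cong g≗g′ i j) (backCount-cong g≗g′ i i) (greedy i j i≤j)

  greedy? : ∀ g → Dec (Greedy g)
  greedy? g = all? λ i → all? λ j → (toℕ i ≤? toℕ j) →-dec (backCount g i j ≤? backCount g i i)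

  backCount-∘ : ∀ g {π : Fin n → Fin n} i j → (∀ {h} → toℕ h < toℕ i → π h ≡ h) →
                backCount (g ∘ π) i j ≡ backCount g i (π j)
  backCount-∘ g {π} i j fixed = count-cong n earlier
    where
    earlier : ∀ h → (does (toℕ h <? toℕ i) ∧ adj (g (π h)) (g (π j)))
                  ≡ (does (toℕ h <? toℕ i) ∧ adj (g h) (g (π j)))
    -- `does (_ <? _)` computes to `_<ᵇ_`, which is therefore what the goal shows.
    earlier h with toℕ h <ᵇ toℕ i in h<ᵇi
    ... | true  = cong (λ u → adj (g u) (g (π j))) (fixed (<ᵇ⇒< _ _ (subst T (sym h<ᵇi) tt)))
    ... | false = refl

  -- Move into position k a vertex at a position ≥ k with the most neighbours before k; as this
  -- is a transposition, positions < k are untouched.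
  greedyBelow-suc : ∀ {k} → k < n → (σ : Fin n ↔ V) → GreedyBelow k (to σ) →
                    ∃ λ (σ′ : Fin n ↔ V) → GreedyBelow (suc k) (to σ′)
  greedyBelow-suc {k} k<n σ greedy = ↔-trans (transpose pos best) σ , greedy′
    where
    open ≤-Reasoning
    g = to σ
    pos = fromℕ< k<n

    toℕ-pos : toℕ pos ≡ k
    toℕ-pos = toℕ-fromℕ< k<n

    choice = argmax (λ j → k ≤? toℕ j) (backCount g pos) (λ j → count-≤ n)
                    (pos , ≤-reflexive (sym toℕ-pos))
    best = proj₁ choice
    k≤best = proj₁ (proj₂ choice)
    best-max = proj₂ (proj₂ choice)

    τ = PC.transpose pos best

    τ-fixes-below : ∀ {h} → toℕ h < k → τ h ≡ h
    τ-fixes-below h<k = transpose-fixes-below (subst (_ <_) (sym toℕ-pos) h<k) (<-≤-trans h<k k≤best)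

    τ-keeps-above : ∀ {b} x → b ≤ k → b ≤ toℕ x → b ≤ toℕ (τ x)
    τ-keeps-above x b≤k =
      transpose-keeps-above pos best x (subst (_ ≤_) (sym toℕ-pos) b≤k) (≤-trans b≤k k≤best)

    shift : ∀ i j → toℕ i ≤ k → backCount (g ∘ τ) i j ≡ backCount g i (τ j)
    shift i j i≤k = backCount-∘ g i j (λ h<i → τ-fixes-below (≤-trans h<i i≤k))

    greedy′ : GreedyBelow (suc k) (g ∘ τ)
    greedy′ i j i<1+k i≤j with m≤n⇒m<n∨m≡n (s≤s⁻¹ i<1+k)
    ... | inj₁ i<k = begin
      backCount (g ∘ τ) i j  ≡⟨ shift i j (<⇒≤ i<k) ⟩
      backCount g i (τ j)    ≤⟨ greedy i (τ j) i<k (τ-keeps-above j (<⇒≤ i<k) i≤j) ⟩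
      backCount g i i        ≡⟨ cong (backCount g i) (τ-fixes-below i<k) ⟨
      backCount g i (τ i)    ≡⟨ shift i i (<⇒≤ i<k) ⟨
      backCount (g ∘ τ) i i  ∎
    ... | inj₂ i≡k with toℕ-injective (trans i≡k (sym toℕ-pos))
    ...   | refl = begin
      backCount (g ∘ τ) pos j    ≡⟨ shift pos j (≤-reflexive toℕ-pos) ⟩
      backCount g pos (τ j)      ≤⟨ best-max (τ j) (τ-keeps-above j ≤-refl (subst (_≤ toℕ j) i≡k i≤j)) ⟩
      backCount g pos best       ≡⟨ cong (backCount g pos) (transpose-at pos best) ⟨
      backCount g pos (τ pos)    ≡⟨ shift pos pos (≤-reflexive toℕ-pos) ⟨
      backCount (g ∘ τ) pos pos  ∎

  greedyBelow : ∀ k → k ≤ n → Fin n ↔ V → ∃ λ (σ : Fin n ↔ V) → GreedyBelow k (to σ)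
  greedyBelow zero    _   σ = σ , λ _ _ ()
  greedyBelow (suc k) k<n σ =
    let σ′ , greedy = greedyBelow k (<⇒≤ k<n) σ in greedyBelow-suc k<n σ′ greedy

  greedy-exists : Fin n ↔ V → ∃ λ (σ : Fin n ↔ V) → Greedy (to σ)
  greedy-exists E = let σ , greedy = greedyBelow n ≤-refl E in σ , λ i j → greedy i j (toℕ<n i)

greedegree-exists : ∀ {V : Set} (adj : V → V → Bool) {n} → Fin (suc n) ↔ V → ∃ (IsGreedegree adj n)
greedegree-exists {V} adj {n} E =
  let σ₀ , greedy₀ = greedy-exists adj E
      d , attained , maximal = greatest Attained attained? (suc n) bounded (_ , σ₀ , greedy₀ , refl)
  in d , attained , λ σ greedy → maximal _ (σ , greedy , refl)
  where
  finalDegreeOf : (Fin (suc n) → V) → ℕ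
  finalDegreeOf g = count (suc n) (λ h → adj (g h) (g (fromℕ n)))

  Attained : ℕ → Set
  Attained c = ∃ λ (σ : Fin (suc n) ↔ V) → Greedy adj (to σ) × finalDegreeOf (to σ) ≡ c

  attained? : ∀ c → Dec (Attained c)
  attained? c = ∃-ordering? E (λ g → greedy? adj g ×-dec (finalDegreeOf g ≟ℕ c))
    λ g≗h (greedy , final≡c) →
      greedy-cong adj g≗h greedy
    , trans (count-cong (suc n) (λ i → sym (cong₂ adj (g≗h i) (g≗h (fromℕ n))))) final≡c

  bounded : ∀ c → Attained c → c ≤ suc n
  bounded c (σ , _ , final≡c) =
    subst (_≤ suc n) final≡c (count-≤ (suc n) {λ h → adj (to σ h) (to σ (fromℕ n))})

-- The formula graph

clauseMax : ∀ {u} → CNF u → ℕ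
clauseMax Φ = foldr _⊔_ 0 (map length (clauses Φ))

LiteralMax : Set
LiteralMax = ∀ {u} → CNF u → (s : ℕ) → (Fin s → Fin u) → ℕ

UnfoldsMaxParam : LiteralMax → Set
UnfoldsMaxParam maxLit = ∀ {s} (Φ : CNF (suc s)) →
  maxParam Φ ≡ clauseMax Φ ⊔ ((2 * occ Φ (zero , true) ⊔ 2 * occ Φ (zero , false)) ⊔ maxLit Φ s suc)

-- `maxParam` maximises 2 p(ℓ) with a helper local to its where-block. It is recovered here as
-- the solution of a unification problem: abstracting `suc s`, `zero` and `suc` leaves the
-- helper applied to variables only.
literalMax : Σ LiteralMax UnfoldsMaxParam
literalMax = helper , unfold
  where
  helper : LiteralMax
  helper = _
  unfold : UnfoldsMaxParam helper
  unfold {s} Φ with suc s | Fin.zero {s} | Fin.suc {s}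
  ... | _ | _ | _ = refl

maxLit : LiteralMax
maxLit = proj₁ literalMax

2*occ≤maxLit : ∀ {u} (Φ : CNF u) s (g : Fin s → Fin u) j p → 2 * occ Φ (g j , p) ≤ maxLit Φ s g
2*occ≤maxLit Φ (suc s) g zero    true  =
  ≤-trans (m≤m⊔n _ (2 * occ Φ (g zero , false))) (m≤m⊔n _ (maxLit Φ s (g ∘ suc)))
2*occ≤maxLit Φ (suc s) g zero    false =
  ≤-trans (m≤n⊔m (2 * occ Φ (g zero , true)) _) (m≤m⊔n _ (maxLit Φ s (g ∘ suc)))
2*occ≤maxLit Φ (suc s) g (suc j) p     = ≤-trans (2*occ≤maxLit Φ s (g ∘ suc) j p) (m≤n⊔m _ _)

2*occ≤maxParam : ∀ {u} (Φ : CNF u) (ℓ : Literal u) → 2 * occ Φ ℓ ≤ maxParam Φ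
2*occ≤maxParam {u} Φ (i , p) = ≤-trans (2*occ≤maxLit Φ u id i p) (m≤n⊔m (clauseMax Φ) _)

length≤clauseMax : ∀ {u} (cs : List (Clause u)) (i : Fin (length cs)) →
                   length (lookup cs i) ≤ foldr _⊔_ 0 (map length cs)
length≤clauseMax (c ∷ cs) zero    = m≤m⊔n _ _
length≤clauseMax (c ∷ cs) (suc i) = ≤-trans (length≤clauseMax cs i) (m≤n⊔m _ _)

length≤maxParam : ∀ {u} (Φ : CNF u) (i : Fin (nClauses Φ)) → length (clause Φ i) ≤ maxParam Φ
length≤maxParam Φ i = ≤-trans (length≤clauseMax (clauses Φ) i) (m≤m⊔n _ _)

1≤maxParam : ∀ {u} (Φ : CNF u) → NonTrivial Φ → 1 ≤ maxParam Φ
1≤maxParam Φ (nonempty , clausesNonempty) =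
  ≤-trans (positive (clauses Φ) nonempty clausesNonempty) (m≤m⊔n _ _)
  where
  positive : ∀ {u} (cs : List (Clause u)) → ¬ cs ≡ [] → All (λ c → ¬ c ≡ []) cs →
             1 ≤ foldr _⊔_ 0 (map length cs)
  positive []             cs≢[] _           = contradiction refl cs≢[]
  positive ([] ∷ cs)      _     (c≢[] ∷ _)  = contradiction refl c≢[]
  positive ((l ∷ c) ∷ cs) _     _           =
    ≤-trans (s≤s z≤n) (m≤m⊔n (length (l ∷ c)) (foldr _⊔_ 0 (map length cs)))

litCount : ∀ {u} → (Literal u → Bool) → ℕ
litCount {u} P = count u (λ i → P (i , true)) + count u (λ i → P (i , false))

litCount-≟ᴸ : ∀ {u} (ℓ : Literal u) → litCount (_≟ᴸ ℓ) ≡ 1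
litCount-≟ᴸ {u} (i , true)  = cong₂ _+_ (trans (count-cong u (λ j → ∧-identityʳ _)) (count-≟ i))
                                         (trans (count-cong u (λ j → ∧-zeroʳ _)) (count-false u))
litCount-≟ᴸ {u} (i , false) = cong₂ _+_ (trans (count-cong u (λ j → ∧-zeroʳ _)) (count-false u))
                                         (trans (count-cong u (λ j → ∧-identityʳ _)) (count-≟ i))

litCount-memᴸ : ∀ {u} (c : Clause u) → litCount (λ ℓ → memᴸ ℓ c) ≤ length c
litCount-memᴸ {u} []      = ≤-reflexive (cong₂ _+_ (count-false u) (count-false u))
litCount-memᴸ {u} (l ∷ c) = begin
  litCount (λ ℓ → (ℓ ≟ᴸ l) ∨ memᴸ ℓ c)
    ≤⟨ +-mono-≤ (count-∨ u _ _) (count-∨ u _ _) ⟩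
  (e⁺ + m⁺) + (e⁻ + m⁻)   ≡⟨ interchange e⁺ m⁺ e⁻ m⁻ ⟩
  (e⁺ + e⁻) + (m⁺ + m⁻)   ≤⟨ +-mono-≤ (≤-reflexive (litCount-≟ᴸ l)) (litCount-memᴸ c) ⟩
  1 + length c            ∎
  where
  open ≤-Reasoning
  e⁺ = count u (λ i → (i , true) ≟ᴸ l)
  e⁻ = count u (λ i → (i , false) ≟ᴸ l)
  m⁺ = count u (λ i → memᴸ (i , true) c)
  m⁻ = count u (λ i → memᴸ (i , false) c)

module FormulaGraph {t : ℕ} (Φ : CNF t) (f : ℕ) where

  private
    k = nClauses Φ
    Vertex = Vtx Φ f

  Blocks : Set
  Blocks = Fin 1 ⊎ (Fin 1 ⊎ ((Fin t ⊎ Fin t) ⊎ (Fin k ⊎ (Fin k ⊎ Fin f))))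

  fromBlocks : Blocks → Vertex
  fromBlocks (inj₁ _)                             = va
  fromBlocks (inj₂ (inj₁ _))                      = vb
  fromBlocks (inj₂ (inj₂ (inj₁ (inj₁ i))))        = lit (i , true)
  fromBlocks (inj₂ (inj₂ (inj₁ (inj₂ i))))        = lit (i , false)
  fromBlocks (inj₂ (inj₂ (inj₂ (inj₁ i))))        = α i
  fromBlocks (inj₂ (inj₂ (inj₂ (inj₂ (inj₁ i))))) = β i
  fromBlocks (inj₂ (inj₂ (inj₂ (inj₂ (inj₂ i))))) = y i

  toBlocks : Vertex → Blocks
  toBlocks va                = inj₁ zero
  toBlocks vb                = inj₂ (inj₁ zero)
  toBlocks (lit (i , true))  = inj₂ (inj₂ (inj₁ (inj₁ i)))
  toBlocks (lit (i , false)) = inj₂ (inj₂ (inj₁ (inj₂ i)))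
  toBlocks (α i)             = inj₂ (inj₂ (inj₂ (inj₁ i)))
  toBlocks (β i)             = inj₂ (inj₂ (inj₂ (inj₂ (inj₁ i))))
  toBlocks (y i)             = inj₂ (inj₂ (inj₂ (inj₂ (inj₂ i))))

  fromBlocks∘toBlocks : ∀ v → fromBlocks (toBlocks v) ≡ v
  fromBlocks∘toBlocks va                = refl
  fromBlocks∘toBlocks vb                = refl
  fromBlocks∘toBlocks (lit (i , true))  = refl
  fromBlocks∘toBlocks (lit (i , false)) = refl
  fromBlocks∘toBlocks (α i)             = refl
  fromBlocks∘toBlocks (β i)             = refl
  fromBlocks∘toBlocks (y i)             = refl

  toBlocks∘fromBlocks : ∀ b → toBlocks (fromBlocks b) ≡ b
  toBlocks∘fromBlocks (inj₁ zero)                          = refl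
  toBlocks∘fromBlocks (inj₂ (inj₁ zero))                   = refl
  toBlocks∘fromBlocks (inj₂ (inj₂ (inj₁ (inj₁ i))))        = refl
  toBlocks∘fromBlocks (inj₂ (inj₂ (inj₁ (inj₂ i))))        = refl
  toBlocks∘fromBlocks (inj₂ (inj₂ (inj₂ (inj₁ i))))        = refl
  toBlocks∘fromBlocks (inj₂ (inj₂ (inj₂ (inj₂ (inj₁ i))))) = refl
  toBlocks∘fromBlocks (inj₂ (inj₂ (inj₂ (inj₂ (inj₂ i))))) = refl

  private
    ι : ∀ {n} → Fin n ↔ Fin n
    ι = ↔-id _

  literalBlocks : Fin (t + t) ↔ (Fin t ⊎ Fin t)
  literalBlocks = ι ⊕ ι

  clauseAndFillerBlocks : Fin (k + (k + f)) ↔ (Fin k ⊎ (Fin k ⊎ Fin f))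
  clauseAndFillerBlocks = ι ⊕ (ι ⊕ ι)

  blockEnumeration : Fin (1 + (1 + ((t + t) + (k + (k + f))))) ↔ Vertex
  blockEnumeration = ↔-trans (ι ⊕ (ι ⊕ (literalBlocks ⊕ clauseAndFillerBlocks)))
                             (mk↔ₛ′ fromBlocks toBlocks fromBlocks∘toBlocks toBlocks∘fromBlocks)

  enumeration : Fin (nOf Φ f) ↔ Vertex
  enumeration = ↔-trans (cast-id (vertexCount t k f)) blockEnumeration
    where
    vertexCount : ∀ t k f → 2 + 2 * t + 2 * k + f ≡ 1 + (1 + ((t + t) + (k + (k + f))))
    vertexCount = solve-∀

  count-vertices : (Q : Vertex → Bool) → count (nOf Φ f) (Q ∘ to enumeration) ≡
      count 1 (λ _ → Q va) + (count 1 (λ _ → Q vb) + (litCount (Q ∘ lit)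
    + (count k (Q ∘ α) + (count k (Q ∘ β) + count f (Q ∘ y)))))
  count-vertices Q =
    trans (count-reindex enumeration blockEnumeration Q)
    (trans (count-⊕ ι (ι ⊕ (literalBlocks ⊕ clauseAndFillerBlocks)) Q₁) (cong (count 1 (λ _ → Q va) +_)
    (trans (count-⊕ ι (literalBlocks ⊕ clauseAndFillerBlocks) Q₂) (cong (count 1 (λ _ → Q vb) +_)
    (trans (count-⊕ literalBlocks clauseAndFillerBlocks Q₃) (cong₂ _+_ (count-⊕ ι ι (Q₃ ∘ inj₁))
    (trans (count-⊕ ι (ι ⊕ ι) Q₄) (cong (count k (Q ∘ α) +_) (count-⊕ ι ι (Q₄ ∘ inj₂))))))))))
    where
    Q₁ = Q ∘ fromBlocks
    Q₂ = Q₁ ∘ inj₂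
    Q₃ = Q₂ ∘ inj₂
    Q₄ = Q₃ ∘ inj₂

  count-vertices-≤ : (Q : Vertex → Bool) {a b c d e g : ℕ} →
    count 1 (λ _ → Q va) ≤ a → count 1 (λ _ → Q vb) ≤ b → litCount (Q ∘ lit) ≤ c →
    count k (Q ∘ α) ≤ d → count k (Q ∘ β) ≤ e → count f (Q ∘ y) ≤ g →
    count (nOf Φ f) (Q ∘ to enumeration) ≤ a + (b + (c + (d + (e + g))))
  count-vertices-≤ Q ≤a ≤b ≤c ≤d ≤e ≤g = ≤-trans (≤-reflexive (count-vertices Q))
    (+-mono-≤ ≤a (+-mono-≤ ≤b (+-mono-≤ ≤c (+-mono-≤ ≤d (+-mono-≤ ≤e ≤g)))))

  gDegree : Vertex → ℕ
  gDegree = degree (gAdj Φ) enumeration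

  closedNbhd : Vertex → Vertex → Bool
  closedNbhd u v = eqV Φ u v ∨ hAdj Φ u v

  closedNbhdSize : Vertex → ℕ
  closedNbhdSize v = count (nOf Φ f) (λ h → closedNbhd (to enumeration h) v)

  gDegree+closedNbhdSize : ∀ v → gDegree v + closedNbhdSize v ≡ nOf Φ f
  gDegree+closedNbhdSize v =
    trans (cong (gDegree v +_) (count-cong (nOf Φ f) (λ h → deMorgan (eqV Φ (u h) v) (hAdj Φ (u h) v))))
          (count-not (nOf Φ f) (λ h → gAdj Φ (u h) v))
    where
    u = to enumeration
    deMorgan : ∀ a b → a ∨ b ≡ not (not a ∧ not b)
    deMorgan true  _     = refl
    deMorgan false true  = refl
    deMorgan false false = refl

  emptyBlock : ∀ n → count n (λ _ → false) ≤ 0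
  emptyBlock n = ≤-reflexive (count-false n)

  gDegree-va : gDegree va ≤ 2 * t + k
  gDegree-va = ≤-trans
    (count-vertices-≤ (λ u → gAdj Φ u va) ≤-refl ≤-refl (+-mono-≤ (count-≤ t) (count-≤ t))
                      (emptyBlock k) (count-≤ k) (emptyBlock f))
    (≤-reflexive (arrange t k))
    where
    arrange : ∀ t k → (t + t) + (0 + (k + 0)) ≡ 2 * t + k
    arrange = solve-∀

  gDegree-vb : gDegree vb ≤ 2 * t + k
  gDegree-vb = ≤-trans
    (count-vertices-≤ (λ u → gAdj Φ u vb) ≤-refl ≤-refl (+-mono-≤ (count-≤ t) (count-≤ t))
                      (count-≤ k) (emptyBlock k) (emptyBlock f))
    (≤-reflexive (arrange t k))
    where
    arrange : ∀ t k → (t + t) + (k + (0 + 0)) ≡ 2 * t + k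
    arrange = solve-∀

  closedNbhd-lit : ∀ ℓ → closedNbhdSize (lit ℓ) ≤ 2 + maxParam Φ
  closedNbhd-lit (i , true) = ≤-trans
    (count-vertices-≤ (λ u → closedNbhd u (lit (i , true))) ≤-refl ≤-refl
      (≤-reflexive (cong₂ _+_
        (trans (count-cong t λ j → trans (∨-identityʳ _) (∧-identityʳ (does (j ≟ i)))) (count-≟ i))
        (trans (count-cong t λ j → cong (_∨ does (i ≟ j)) (∧-zeroʳ (does (j ≟ i)))) (count-≟′ i))))
      (≤-reflexive (count-cong k λ _ → ∨-identityʳ _))
      (≤-reflexive (count-cong k λ _ → ∨-identityʳ _))
      (emptyBlock f))
    (+-monoʳ-≤ 2 (2*occ≤maxParam Φ (i , true)))
  closedNbhd-lit (i , false) = ≤-trans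
    (count-vertices-≤ (λ u → closedNbhd u (lit (i , false))) ≤-refl ≤-refl
      (≤-reflexive (cong₂ _+_
        (trans (count-cong t λ j → trans (cong (_∨ (does (j ≟ i) ∨ false)) (∧-zeroʳ (does (j ≟ i))))
                                          (∨-identityʳ _)) (count-≟ i))
        (trans (count-cong t λ j → trans (∨-identityʳ _) (∧-identityʳ (does (j ≟ i)))) (count-≟ i))))
      (≤-reflexive (count-cong k λ _ → ∨-identityʳ _))
      (≤-reflexive (count-cong k λ _ → ∨-identityʳ _))
      (emptyBlock f))
    (+-monoʳ-≤ 2 (2*occ≤maxParam Φ (i , false)))

  closedNbhd-α : ∀ i → closedNbhdSize (α i) ≤ 2 + maxParam Φ
  closedNbhd-α i = begin
    closedNbhdSize (α i)
      ≤⟨ count-vertices-≤ (λ u → closedNbhd u (α i)) ≤-refl ≤-refl (litCount-memᴸ (clause Φ i))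
           (≤-reflexive (trans (count-cong k λ _ → ∨-identityʳ _) (count-≟ i)))
           (emptyBlock k) (emptyBlock f) ⟩
    1 + (0 + (length (clause Φ i) + (1 + (0 + 0))))  ≡⟨ cong suc (+-comm (length (clause Φ i)) 1) ⟩
    2 + length (clause Φ i)                          ≤⟨ +-monoʳ-≤ 2 (length≤maxParam Φ i) ⟩
    2 + maxParam Φ                                   ∎
    where open ≤-Reasoning

  closedNbhd-β : ∀ i → closedNbhdSize (β i) ≤ 2 + maxParam Φ
  closedNbhd-β i = begin
    closedNbhdSize (β i)
      ≤⟨ count-vertices-≤ (λ u → closedNbhd u (β i)) ≤-refl ≤-refl (litCount-memᴸ (clause Φ i))
           (emptyBlock k) (≤-reflexive (trans (count-cong k λ _ → ∨-identityʳ _) (count-≟ i)))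
           (emptyBlock f) ⟩
    0 + (1 + (length (clause Φ i) + (0 + (1 + 0))))  ≡⟨ cong suc (+-comm (length (clause Φ i)) 1) ⟩
    2 + length (clause Φ i)                          ≤⟨ +-monoʳ-≤ 2 (length≤maxParam Φ i) ⟩
    2 + maxParam Φ                                   ∎
    where open ≤-Reasoning

  closedNbhd-y : NonTrivial Φ → ∀ i → closedNbhdSize (y i) ≤ 2 + maxParam Φ
  closedNbhd-y nonTrivial i = ≤-trans
    (count-vertices-≤ (λ u → closedNbhd u (y i)) ≤-refl ≤-refl
      (≤-reflexive (cong₂ _+_ (count-false t) (count-false t))) (emptyBlock k) (emptyBlock k)
      (≤-reflexive (trans (count-cong f λ _ → ∨-identityʳ _) (count-≟ i))))
    (+-monoʳ-≤ 2 (1≤maxParam Φ nonTrivial))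

  gDegree-large : ∀ v {c} → closedNbhdSize v ≤ c → nOf Φ f ≤ gDegree v + c
  gDegree-large v {c} bound =
    subst (_≤ gDegree v + c) (gDegree+closedNbhdSize v) (+-monoʳ-≤ (gDegree v) bound)

  small-or-large : NonTrivial Φ → ∀ v → gDegree v ≤ 2 * t + k ⊎ nOf Φ f ≤ gDegree v + (2 + maxParam Φ)
  small-or-large _          va      = inj₁ gDegree-va
  small-or-large _          vb      = inj₁ gDegree-vb
  small-or-large _          (lit ℓ) = inj₂ (gDegree-large (lit ℓ) (closedNbhd-lit ℓ))
  small-or-large _          (α i)   = inj₂ (gDegree-large (α i) (closedNbhd-α i))
  small-or-large _          (β i)   = inj₂ (gDegree-large (β i) (closedNbhd-β i))
  small-or-large nonTrivial (y i)   = inj₂ (gDegree-large (y i) (closedNbhd-y nonTrivial i))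

above-threshold : ∀ {r s n d m} → 0 < s → n ≤ d + (2 + m) → s * (m + 3) ≤ r * n → s * n < s * d + r * n
above-threshold {r} {s} {n} {d} {m} 0<s n≤d+2+m s[m+3]≤rn = begin-strict
  s * n                ≤⟨ *-monoʳ-≤ s n≤d+2+m ⟩
  s * (d + (2 + m))    ≡⟨ *-distribˡ-+ s d (2 + m) ⟩
  s * d + s * (2 + m)  <⟨ +-monoʳ-< (s * d) (*-monoʳ-< s {{>-nonZero 0<s}} (≤-reflexive (+-comm 3 m))) ⟩
  s * d + s * (m + 3)  ≤⟨ +-monoʳ-≤ (s * d) s[m+3]≤rn ⟩
  s * d + r * n        ∎
  where open ≤-Reasoning

mainTheorem18 : ∀ {t : ℕ} (Φ : CNF t) → NonTrivial Φ →
    (r s : ℕ) → 0 < r → 2 * r ≤ s →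
    (f : ℕ) → IsFillerCount Φ r s f →
    Σ ℕ λ d → IsGreedegree (gAdj Φ {f}) (1 + 2 * t + 2 * nClauses Φ + f) d
      × (s * nOf Φ f < s * d + r * nOf Φ f ⊎ s * d ≤ r * nOf Φ f)
mainTheorem18 {t} Φ nonTrivial r s 0<r 2r≤s f ((_ , 2t+k≤εn , m+3≤εn) , _) =
  d , greedegree , ⊎.map highDegree lowDegree (⊎.swap (small-or-large nonTrivial v))
  where
  open FormulaGraph Φ f
  n = 1 + 2 * t + 2 * nClauses Φ + f

  existence : ∃ (IsGreedegree (gAdj Φ {f}) n)
  existence = greedegree-exists (gAdj Φ) enumeration

  d = proj₁ existence
  greedegree = proj₂ existence
  σ = proj₁ (proj₁ greedegree)
  v = to σ (fromℕ n)

  gDegree≡d : gDegree v ≡ d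
  gDegree≡d =
    trans (count-reindex enumeration σ (λ u → gAdj Φ u v)) (proj₂ (proj₂ (proj₁ greedegree)))

  0<s : 0 < s
  0<s = ≤-trans 0<r (≤-trans (m≤m+n r (r + 0)) 2r≤s)

  highDegree : nOf Φ f ≤ gDegree v + (2 + maxParam Φ) → s * nOf Φ f < s * d + r * nOf Φ f
  highDegree large =
    above-threshold {r} 0<s (subst (λ e → nOf Φ f ≤ e + (2 + maxParam Φ)) gDegree≡d large) m+3≤εn

  lowDegree : gDegree v ≤ 2 * t + nClauses Φ → s * d ≤ r * nOf Φ f
  lowDegree small = ≤-trans (*-monoʳ-≤ s (subst (_≤ 2 * t + nClauses Φ) gDegree≡d small)) 2t+k≤εn
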